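{- Let $(G,k,c)$ be an instance of Capacitated $k$-Vertex Cover and $X$ a vertex cover of $G$. Suppose $S\subseteq V(G)\setminus X$ is a set of vertices all having the same neighbourhood in $X$ with $|S|>k+1$. Let $s\in S$ have minimum capacity among the vertices of $S$, and let $(G',k,c')$ be obtained by deleting $s$ (so $G'=G-s$) and setting $c'(v)=c(v)-1$ for each neighbour $v$ of $s$ and $c'(v)=c(v)$ otherwise. Then $(G,k,c)$ is a yes-instance if and only if $(G',k,c')$ is.
   Context: Capacitated $k$-Vertex Cover: given a graph $G$, a capacity function $c:V(G)\to\mathbb N$ and an integer $k$, decide whether $G$ has a capacitated vertex cover of size at most $k$, i.e. a vertex cover $X$ admitting a map $\rho:E(G)\to X$ assigning each edge to one of its endpoints in $X$ with $|\rho^{ -1}(x)|\le c(x)$ for all $x\in X$. -}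

module Defs where

open import Data.Nat using (ℕ; zero; suc; _≤_; _<_; _∸_)
open import Data.Bool using (Bool; true; false; if_then_else_)
open import Data.Bool.Properties using () renaming (_≟_ to _≟ᵇ_)
open import Data.Fin using (Fin; punchIn) renaming (_<_ to _<ᶠ_)
open import Data.Fin.Properties using () renaming (_<?_ to _<ᶠ?_; _≟_ to _≟ᶠ_)
open import Data.Fin.Subset using (Subset; _∈_; _∉_; ∣_∣)
open import Data.List using (List; filter; length; concatMap; map; allFin)
open import Data.List.Relation.Unary.All using (All)
open import Data.Product using (Σ; _×_; _,_; proj₁; proj₂)
open import Data.Sum using (_⊎_)
open import Relation.Binary.PropositionalEquality using (_≡_)
open import Relation.Nullary.Decidable using (Dec; _×-dec_)

record Graph (n : ℕ) : Set where
  field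
    adj    : Fin n → Fin n → Bool
    sym    : ∀ u v → adj u v ≡ adj v u
    irrefl : ∀ v → adj v v ≡ false
open Graph public

-- The edge {u,v} (u ≠ v, adjacent) is represented once, as the ordered
-- pair (u , v) with u < v.
IsEdge : ∀ {n} → Graph n → Fin n × Fin n → Set
IsEdge G (u , v) = (u <ᶠ v) × (adj G u v ≡ true)

isEdge? : ∀ {n} (G : Graph n) (e : Fin n × Fin n) → Dec (IsEdge G e)
isEdge? G (u , v) = (u <ᶠ? v) ×-dec (adj G u v ≟ᵇ true)

allPairs : (n : ℕ) → List (Fin n × Fin n)
allPairs n = concatMap (λ u → map (λ v → (u , v)) (allFin n)) (allFin n)

edges : ∀ {n} → Graph n → List (Fin n × Fin n)
edges G = filter (isEdge? G) (allPairs _)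

endpoint : ∀ {n} → Fin n × Fin n → Fin n → Set
endpoint (u , v) x = (x ≡ u) ⊎ (x ≡ v)

IsVertexCover : ∀ {n} → Graph n → Subset n → Set
IsVertexCover G X = All (λ e → (proj₁ e ∈ X) ⊎ (proj₂ e ∈ X)) (edges G)

load : ∀ {n} → Graph n → (Fin n × Fin n → Fin n) → Fin n → ℕ
load G ρ x = length (filter (λ e → ρ e ≟ᶠ x) (edges G))

IsCapVertexCover : ∀ {n} → Graph n → (Fin n → ℕ) → Subset n → Set
IsCapVertexCover G c X =
  IsVertexCover G X ×
  Σ (Fin n × Fin n → Fin n) λ ρ →
    All (λ e → endpoint e (ρ e) × (ρ e ∈ X)) (edges G) ×
    (∀ x → x ∈ X → load G ρ x ≤ c x)
  where n = _

YesInstance : ∀ {n} → Graph n → ℕ → (Fin n → ℕ) → Set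
YesInstance {n} G k c = Σ (Subset n) λ X → (∣ X ∣ ≤ k) × IsCapVertexCover G c X

-- G - s : vertices Fin m are identified with the vertices ≠ s of G via punchIn s.
deleteVertex : ∀ {m} → Graph (suc m) → Fin (suc m) → Graph m
deleteVertex G s = record
  { adj    = λ i j → adj G (punchIn s i) (punchIn s j)
  ; sym    = λ i j → sym G (punchIn s i) (punchIn s j)
  ; irrefl = λ i → irrefl G (punchIn s i)
  }

-- c'(v) = c(v) - 1 for neighbours v of s, c'(v) = c(v) otherwise
-- (truncated subtraction on ℕ).
reducedCapacity : ∀ {m} → Graph (suc m) → (Fin (suc m) → ℕ) → Fin (suc m) → Fin m → ℕ
reducedCapacity G c s i =
  if adj G s (punchIn s i) then c (punchIn s i) ∸ 1 else c (punchIn s i)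

{-# OPTIONS --safe #-}
-- A solution Y has |Y| ≤ k while |S| ≥ k + 2, so some t ∈ S ∖ {s} lies outside Y. As X is a vertex
-- cover avoiding S, all vertices of S have the same neighbourhood N; since t ∉ Y, every v ∈ N is in Y
-- and carries the edge tv.
-- Forward: the transposition (s t) is an automorphism of G, and it turns Y into a solution avoiding s,
-- still feasible because c s ≤ c t. Deleting s then relieves each v ∈ N of exactly the edge sv,
-- matching c'(v) = c(v) - 1.
-- Backward: put s back outside the cover and give each edge sv to v. In G - s the vertex v already
-- carries tv, so c'(v) ≥ 1, the subtraction c(v) - 1 does not truncate, and sv fits into c(v).
module Submission where

open import Defs renaming (sym to adj-sym; irrefl to adj-irrefl)
open import Data.Nat using (ℕ; zero; suc; _+_; _∸_; _≤_; _<_; z≤n; s≤s; s≤s⁻¹)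
open import Data.Nat.Properties
  using (+-*-semiring; +-identityʳ; <⇒≱; ≤-refl; ≤-trans; ≤-reflexive; m≤m+n; m≤n+m; +-monoˡ-≤; m∸n≤m;
         module ≤-Reasoning)
open import Data.Bool using (Bool; true; false; _∧_; if_then_else_)
open import Data.Bool.Properties using (∧-identityʳ) renaming (_≟_ to _≟ᵇ_)
open import Data.Fin using (Fin; zero; suc; punchIn)
open import Data.Fin.Properties
  using (_≟_; _<?_; <-cmp; <-irrefl; <-asym; punchInᵢ≢i; punchIn-injective; ¬∀⟶∃¬)
open import Data.List using (List; []; _∷_; _++_; filter; length; concatMap; map; allFin; tabulate)
import Data.List.Properties as List
open import Data.Nat.ListAction using () renaming (sum to listSum)
open import Data.Nat.ListAction.Properties using () renaming (sum-++ to listSum-++)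
open import Data.Product using (∃; _×_; _,_; proj₁; proj₂)
open import Data.Sum using (_⊎_; inj₁; inj₂)
import Data.Sum as Sum
open import Data.Fin.Subset using (Subset; _∈_; _∉_; ∣_∣)
open import Data.Fin.Subset.Properties using (_∈?_; p⊆q⇒∣p∣≤∣q∣)
open import Data.Fin.Permutation using (Permutation; _⟨$⟩ʳ_; _⟨$⟩ˡ_; inverseˡ; inverseʳ; transpose)
open import Data.Vec using (Vec; []; _∷_; lookup; insertAt; removeAt) renaming (tabulate to tabulateᵥ)
open import Data.Vec.Properties
  using ([]=⇒lookup; lookup⇒[]=; insertAt-lookup; insertAt-punchIn; insertAt-removeAt; lookup∘tabulate)
open import Data.List.Relation.Unary.All as All using (All)
open import Data.List.Membership.Propositional using () renaming (_∈_ to _∈ₗ_)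
open import Data.List.Membership.Propositional.Properties
  using (∈-filter⁺; ∈-filter⁻; ∈-concat⁺′; ∈-map⁺; ∈-allFin)
open import Function using (_∘_)
open import Function.Bundles using (_⇔_; mk⇔)
open import Relation.Binary using (tri<; tri≈; tri>)
open import Relation.Binary.PropositionalEquality
open import Relation.Nullary using (Dec; does; yes; no; ¬_; contradiction)
open import Relation.Nullary.Decidable using (dec-true; dec-false; _→-dec_)
open import Relation.Unary using (Decidable)
open import Algebra.Properties.Semiring.Sum +-*-semiring
  using (sum-syntax; sum-remove; sum-cong-≗; sum-replicate-zero; ∑-distrib-+; sum-permute)

𝟙 : Bool → ℕ
𝟙 true  = 1
𝟙 false = 0

∑-zero : ∀ {n} {f : Fin n → ℕ} → (∀ i → f i ≡ 0) → ∑[ i < n ] f i ≡ 0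
∑-zero {n} f≡0 = trans (sum-cong-≗ f≡0) (sum-replicate-zero n)

length-filter² : ∀ {A : Set} {P Q : A → Set} (P? : Decidable P) (Q? : Decidable Q) (xs : List A) →
                 length (filter Q? (filter P? xs)) ≡ listSum (map (λ x → 𝟙 (does (P? x) ∧ does (Q? x))) xs)
length-filter² P? Q? []       = refl
length-filter² P? Q? (x ∷ xs) with does (P? x)
... | false = length-filter² P? Q? xs
... | true with does (Q? x)
...   | true  = cong suc (length-filter² P? Q? xs)
...   | false = length-filter² P? Q? xs

listSum-tabulate : ∀ {n} (f : Fin n → ℕ) → listSum (tabulate f) ≡ ∑[ i < n ] f i
listSum-tabulate {zero}  f = refl
listSum-tabulate {suc n} f = cong (f zero +_) (listSum-tabulate (f ∘ suc))

listSum-map-allFin : ∀ {n} (f : Fin n → ℕ) → listSum (map f (allFin n)) ≡ ∑[ i < n ] f i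
listSum-map-allFin {n} f = trans (cong listSum (List.map-tabulate (λ i → i) f)) (listSum-tabulate f)

listSum-concatMap : ∀ {A B : Set} (g : B → ℕ) (h : A → List B) (xs : List A) →
                    listSum (map g (concatMap h xs)) ≡ listSum (map (λ x → listSum (map g (h x))) xs)
listSum-concatMap g h []       = refl
listSum-concatMap g h (x ∷ xs) = begin
  listSum (map g (h x ++ concatMap h xs))
    ≡⟨ cong listSum (List.map-++ g (h x) _) ⟩
  listSum (map g (h x) ++ map g (concatMap h xs))
    ≡⟨ listSum-++ (map g (h x)) _ ⟩
  listSum (map g (h x)) + listSum (map g (concatMap h xs))
    ≡⟨ cong (listSum (map g (h x)) +_) (listSum-concatMap g h xs) ⟩
  listSum (map g (h x)) + listSum (map (λ x → listSum (map g (h x))) xs) ∎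
  where open ≡-Reasoning

listSum-allPairs : ∀ {n} (g : Fin n × Fin n → ℕ) →
                   listSum (map g (allPairs n)) ≡ ∑[ u < n ] ∑[ v < n ] g (u , v)
listSum-allPairs {n} g = begin
  listSum (map g (allPairs n))
    ≡⟨ listSum-concatMap g (λ u → map (u ,_) (allFin n)) (allFin n) ⟩
  listSum (map (λ u → listSum (map g (map (u ,_) (allFin n)))) (allFin n))
    ≡⟨ cong listSum (List.map-cong row (allFin n)) ⟩
  listSum (map (λ u → ∑[ v < n ] g (u , v)) (allFin n))
    ≡⟨ listSum-map-allFin (λ u → ∑[ v < n ] g (u , v)) ⟩
  ∑[ u < n ] ∑[ v < n ] g (u , v) ∎
  where
  open ≡-Reasoning
  row : ∀ u → listSum (map g (map (u ,_) (allFin n))) ≡ ∑[ v < n ] g (u , v)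
  row u = trans (cong listSum (sym (List.map-∘ (allFin n)))) (listSum-map-allFin (λ v → g (u , v)))

∑∑-cross : ∀ {n} (f : Fin n → Fin n → ℕ) (x : Fin n) → f x x ≡ 0 →
           (∀ u v → u ≢ x → v ≢ x → f u v ≡ 0) →
           ∑[ u < n ] ∑[ v < n ] f u v ≡ ∑[ v < n ] (f x v + f v x)
∑∑-cross {suc n} f x fxx≡0 off-cross≡0 = begin
  ∑[ u < suc n ] ∑[ v < suc n ] f u v
    ≡⟨ sum-remove {i = x} (λ u → ∑[ v < suc n ] f u v) ⟩
  ∑[ v < suc n ] f x v + ∑[ j < n ] ∑[ v < suc n ] f (punchIn x j) v
    ≡⟨ cong (∑[ v < suc n ] f x v +_) (sum-cong-≗ row) ⟩
  ∑[ v < suc n ] f x v + ∑[ j < n ] f (punchIn x j) x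
    ≡⟨ cong (∑[ v < suc n ] f x v +_) column ⟨
  ∑[ v < suc n ] f x v + ∑[ v < suc n ] f v x
    ≡⟨ ∑-distrib-+ (f x) (λ v → f v x) ⟨
  ∑[ v < suc n ] (f x v + f v x) ∎
  where
  open ≡-Reasoning
  row : ∀ j → ∑[ v < suc n ] f (punchIn x j) v ≡ f (punchIn x j) x
  row j = begin
    ∑[ v < suc n ] f (punchIn x j) v
      ≡⟨ sum-remove {i = x} (f (punchIn x j)) ⟩
    f (punchIn x j) x + ∑[ k < n ] f (punchIn x j) (punchIn x k)
      ≡⟨ cong (f (punchIn x j) x +_) (∑-zero (λ k → off-cross≡0 _ _ (punchInᵢ≢i x j) (punchInᵢ≢i x k))) ⟩
    f (punchIn x j) x + 0
      ≡⟨ +-identityʳ _ ⟩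
    f (punchIn x j) x ∎
  column : ∑[ v < suc n ] f v x ≡ ∑[ j < n ] f (punchIn x j) x
  column = trans (sum-remove {i = x} (λ v → f v x)) (cong (_+ ∑[ j < n ] f (punchIn x j) x) fxx≡0)

-- Loads as counts over neighbours

owns : ∀ {n} → Graph n → (Fin n → Fin n → Fin n) → Fin n → Fin n → ℕ
owns G f x v = 𝟙 (adj G x v ∧ does (f x v ≟ x))

owned : ∀ {n} → Graph n → (Fin n → Fin n → Fin n) → Fin n → ℕ
owned {n} G f x = ∑[ v < n ] owns G f x v

owned-cong : ∀ {n} (G : Graph n) {f g : Fin n → Fin n → Fin n} {x} →
             (∀ {v} → adj G x v ≡ true → f x v ≡ g x v) → owned G f x ≡ owned G g x
owned-cong G {f} {g} {x} f≡g = sum-cong-≗ owns≡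
  where
  owns≡ : ∀ v → owns G f x v ≡ owns G g x v
  owns≡ v with adj G x v in x~v
  ... | true  = cong (λ y → 𝟙 (does (y ≟ x))) (f≡g x~v)
  ... | false = refl

owns≤owned : ∀ {n} (G : Graph n) f x v → owns G f x v ≤ owned G f x
owns≤owned {suc n} G f x v = subst (owns G f x v ≤_) (sym (sum-remove {i = v} (owns G f x))) (m≤m+n _ _)

-- ρ is only ever consulted on the ordered pairs (u , v) with u < v that list the edges.
unordered : ∀ {n} → (Fin n × Fin n → Fin n) → Fin n → Fin n → Fin n
unordered ρ u v = if does (u <? v) then ρ (u , v) else ρ (v , u)

does-≟true : ∀ b → does (b ≟ᵇ true) ≡ b
does-≟true true  = refl
does-≟true false = refl

module _ {n} (G : Graph n) (ρ : Fin n × Fin n → Fin n) (x : Fin n) where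

  private
    assigned : Fin n → Fin n → ℕ
    assigned u v = 𝟙 (does (isEdge? G (u , v)) ∧ does (ρ (u , v) ≟ x))

  load≡∑∑ : load G ρ x ≡ ∑[ u < n ] ∑[ v < n ] assigned u v
  load≡∑∑ = trans (length-filter² (isEdge? G) (λ e → ρ e ≟ x) (allPairs n))
                  (listSum-allPairs (λ e → 𝟙 (does (isEdge? G e) ∧ does (ρ e ≟ x))))

  load≡owned : (∀ {u v} → IsEdge G (u , v) → endpoint (u , v) (ρ (u , v))) →
               load G ρ x ≡ owned G (unordered ρ) x
  load≡owned ρ-endpoint = begin
    load G ρ x                                   ≡⟨ load≡∑∑ ⟩
    ∑[ u < n ] ∑[ v < n ] assigned u v           ≡⟨ ∑∑-cross assigned x assigned-xx assigned-off ⟩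
    ∑[ v < n ] (assigned x v + assigned v x)     ≡⟨ sum-cong-≗ assigned-both ⟩
    owned G (unordered ρ) x                      ∎
    where
    open ≡-Reasoning
    assigned-xx : assigned x x ≡ 0
    assigned-xx rewrite dec-false (x <? x) (<-irrefl refl) = refl
    assigned-off : ∀ u v → u ≢ x → v ≢ x → assigned u v ≡ 0
    assigned-off u v u≢x v≢x = off (isEdge? G (u , v)) (ρ (u , v) ≟ x)
      where
      off : (uv? : Dec (IsEdge G (u , v))) (ρ≡x? : Dec (ρ (u , v) ≡ x)) → 𝟙 (does uv? ∧ does ρ≡x?) ≡ 0
      off (no _)   _           = refl
      off (yes _)  (no _)      = refl
      off (yes uv) (yes ρ≡x) with ρ-endpoint uv
      ... | inj₁ ρ≡u = contradiction (trans (sym ρ≡u) ρ≡x) u≢x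
      ... | inj₂ ρ≡v = contradiction (trans (sym ρ≡v) ρ≡x) v≢x
    assigned-both : ∀ v → assigned x v + assigned v x ≡ owns G (unordered ρ) x v
    assigned-both v with <-cmp x v
    ... | tri< x<v _ _
      rewrite dec-true (x <? v) x<v | dec-false (v <? x) (<-asym x<v) | does-≟true (adj G x v)
      = +-identityʳ _
    ... | tri≈ _ refl _
      rewrite dec-false (x <? x) (<-irrefl refl) | adj-irrefl G x = refl
    ... | tri> _ _ v<x
      rewrite dec-false (x <? v) (<-asym v<x) | dec-true (v <? x) v<x | does-≟true (adj G v x)
      | adj-sym G x v = refl

-- The assignment ρ of a capacitated vertex cover, recast as a symmetric choice of endpoint for
-- each adjacent pair, so that the load of x becomes a sum over the neighbours of x.
record CapAssignment {n} (G : Graph n) (c : Fin n → ℕ) (Y : Subset n) : Set where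
  field
    pick     : Fin n → Fin n → Fin n
    pick-sym : ∀ {u v} → adj G u v ≡ true → pick u v ≡ pick v u
    pick-end : ∀ {u v} → adj G u v ≡ true → pick u v ≡ u ⊎ pick u v ≡ v
    pick-∈   : ∀ {u v} → adj G u v ≡ true → pick u v ∈ Y
    owned≤c  : ∀ {x} → x ∈ Y → owned G pick x ≤ c x

adj⇒≢ : ∀ {n} (G : Graph n) {u v} → adj G u v ≡ true → u ≢ v
adj⇒≢ G {u} u~v refl with () ← trans (sym u~v) (adj-irrefl G u)

∈-edges⁺ : ∀ {n} (G : Graph n) {e} → IsEdge G e → e ∈ₗ edges G
∈-edges⁺ {n} G {u , v} uv = ∈-filter⁺ (isEdge? G)
  (∈-concat⁺′ (∈-map⁺ (u ,_) (∈-allFin v)) (∈-map⁺ (λ u → map (u ,_) (allFin n)) (∈-allFin u))) uv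

∈-edges⁻ : ∀ {n} (G : Graph n) {e} → e ∈ₗ edges G → IsEdge G e
∈-edges⁻ {n} G = proj₂ ∘ ∈-filter⁻ (isEdge? G) {xs = allPairs n}

unordered-sym : ∀ {n} (ρ : Fin n × Fin n → Fin n) {u v} → u ≢ v → unordered ρ u v ≡ unordered ρ v u
unordered-sym ρ {u} {v} u≢v with <-cmp u v
... | tri< u<v _ _ rewrite dec-true (u <? v) u<v | dec-false (v <? u) (<-asym u<v) = refl
... | tri≈ _ u≡v _ = contradiction u≡v u≢v
... | tri> _ _ v<u rewrite dec-false (u <? v) (<-asym v<u) | dec-true (v <? u) v<u = refl

adj⇒covered : ∀ {n} {G : Graph n} {X} → IsVertexCover G X → ∀ {u v} → adj G u v ≡ true → u ∈ X ⊎ v ∈ X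
adj⇒covered {G = G} vc {u} {v} u~v with <-cmp u v
... | tri< u<v _ _ = All.lookup vc (∈-edges⁺ G (u<v , u~v))
... | tri≈ _ u≡v _ = contradiction u≡v (adj⇒≢ G u~v)
... | tri> _ _ v<u = Sum.swap (All.lookup vc (∈-edges⁺ G (v<u , trans (adj-sym G v u) u~v)))

twins : ∀ {n} {G : Graph n} {X} → IsVertexCover G X → ∀ {u v} → u ∉ X → v ∉ X →
        (∀ x → x ∈ X → adj G u x ≡ adj G v x) → ∀ w → adj G u w ≡ adj G v w
twins {G = G} {X} vc {u} {v} u∉X v∉X same-in-X w with w ∈? X
... | yes w∈X = same-in-X w w∈X
... | no  w∉X = trans (non-adj u∉X) (sym (non-adj v∉X))
  where
  non-adj : ∀ {u} → u ∉ X → adj G u w ≡ false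
  non-adj {u} u∉X with adj G u w in u~w
  ... | false = refl
  ... | true  = contradiction (adj⇒covered {G = G} vc u~w) Sum.[ u∉X , w∉X ]

module _ {n} {G : Graph n} {c : Fin n → ℕ} {Y : Subset n} where

  fromCapVertexCover : IsCapVertexCover G c Y → CapAssignment G c Y
  fromCapVertexCover (_ , ρ , ρ-ok , load≤c) = record
    { pick     = unordered ρ
    ; pick-sym = λ u~v → unordered-sym ρ (adj⇒≢ G u~v)
    ; pick-end = proj₁ ∘ unordered-ok
    ; pick-∈   = proj₂ ∘ unordered-ok
    ; owned≤c  = λ {x} x∈Y → subst (_≤ c x) (load≡owned G ρ x (proj₁ ∘ on-edge)) (load≤c x x∈Y)
    }
    where
    on-edge : ∀ {e} → IsEdge G e → endpoint e (ρ e) × ρ e ∈ Y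
    on-edge = All.lookup ρ-ok ∘ ∈-edges⁺ G
    unordered-ok : ∀ {u v} → adj G u v ≡ true →
                   (unordered ρ u v ≡ u ⊎ unordered ρ u v ≡ v) × unordered ρ u v ∈ Y
    unordered-ok {u} {v} u~v with <-cmp u v
    ... | tri< u<v _ _ rewrite dec-true (u <? v) u<v = on-edge (u<v , u~v)
    ... | tri≈ _ u≡v _ = contradiction u≡v (adj⇒≢ G u~v)
    ... | tri> _ _ v<u rewrite dec-false (u <? v) (<-asym v<u) with on-edge (v<u , trans (adj-sym G v u) u~v)
    ...   | inj₁ ρ≡v , ρ∈Y = inj₂ ρ≡v , ρ∈Y
    ...   | inj₂ ρ≡u , ρ∈Y = inj₁ ρ≡u , ρ∈Y

  toCapVertexCover : CapAssignment G c Y → IsCapVertexCover G c Y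
  toCapVertexCover A = All.tabulate (cover ∘ ∈-edges⁻ G) , ρ , All.tabulate (ρ-ok ∘ ∈-edges⁻ G) , load≤c
    where
    open CapAssignment A
    ρ : Fin n × Fin n → Fin n
    ρ (u , v) = pick u v
    ρ-ok : ∀ {e} → IsEdge G e → endpoint e (ρ e) × ρ e ∈ Y
    ρ-ok (_ , u~v) = pick-end u~v , pick-∈ u~v
    cover : ∀ {e} → IsEdge G e → proj₁ e ∈ Y ⊎ proj₂ e ∈ Y
    cover (_ , u~v) with pick-end u~v
    ... | inj₁ pick≡u = inj₁ (subst (_∈ Y) pick≡u (pick-∈ u~v))
    ... | inj₂ pick≡v = inj₂ (subst (_∈ Y) pick≡v (pick-∈ u~v))
    unordered≡pick : ∀ {x v} → adj G x v ≡ true → unordered ρ x v ≡ pick x v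
    unordered≡pick {x} {v} x~v with does (x <? v)
    ... | true  = refl
    ... | false = pick-sym (trans (adj-sym G v x) x~v)
    load≤c : ∀ x → x ∈ Y → load G ρ x ≤ c x
    load≤c x x∈Y = subst (_≤ c x)
      (sym (trans (load≡owned G ρ x (pick-end ∘ proj₂)) (owned-cong G {unordered ρ} {pick} unordered≡pick)))
      (owned≤c x∈Y)

weaken-capacity : ∀ {n} {G : Graph n} {c d : Fin n → ℕ} {Y} →
                  CapAssignment G c Y → (∀ {x} → x ∈ Y → c x ≤ d x) → CapAssignment G d Y
weaken-capacity A c≤d = record
  { pick = pick ; pick-sym = pick-sym ; pick-end = pick-end ; pick-∈ = pick-∈
  ; owned≤c = λ x∈Y → ≤-trans (owned≤c x∈Y) (c≤d x∈Y)
  }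
  where open CapAssignment A

module _ {n} {G : Graph n} {c Y} (A : CapAssignment G c Y) where
  open CapAssignment A

  owns-∉ : ∀ {x} → x ∉ Y → ∀ v → owns G pick v x ≡ 𝟙 (adj G v x)
  owns-∉ {x} x∉Y v with adj G v x in v~x
  ... | false = refl
  ... | true with pick-end v~x
  ...   | inj₁ pick≡v rewrite pick≡v | dec-true (v ≟ v) refl = refl
  ...   | inj₂ pick≡x = contradiction (subst (_∈ Y) pick≡x (pick-∈ v~x)) x∉Y

  adj-∉ : ∀ {x v} → x ∉ Y → adj G v x ≡ true → v ∈ Y
  adj-∉ x∉Y v~x with pick-end v~x
  ... | inj₁ pick≡v = subst (_∈ Y) pick≡v (pick-∈ v~x)
  ... | inj₂ pick≡x = contradiction (subst (_∈ Y) pick≡x (pick-∈ v~x)) x∉Y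

∣p∣≡∑ : ∀ {n} (p : Subset n) → ∣ p ∣ ≡ ∑[ i < n ] 𝟙 (lookup p i)
∣p∣≡∑ []          = refl
∣p∣≡∑ (true ∷ p)  = cong suc (∣p∣≡∑ p)
∣p∣≡∑ (false ∷ p) = ∣p∣≡∑ p

∣insertAt∣ : ∀ {n} (p : Subset n) i x → ∣ insertAt p i x ∣ ≡ 𝟙 x + ∣ p ∣
∣insertAt∣ {n} p i x = begin
  ∣ insertAt p i x ∣
    ≡⟨ ∣p∣≡∑ (insertAt p i x) ⟩
  ∑[ j < suc n ] 𝟙 (lookup (insertAt p i x) j)
    ≡⟨ sum-remove {i = i} (𝟙 ∘ lookup (insertAt p i x)) ⟩
  𝟙 (lookup (insertAt p i x) i) + ∑[ j < n ] 𝟙 (lookup (insertAt p i x) (punchIn i j))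
    ≡⟨ cong₂ _+_ (cong 𝟙 (insertAt-lookup p i x)) (sum-cong-≗ (cong 𝟙 ∘ insertAt-punchIn p i x)) ⟩
  𝟙 x + ∑[ j < n ] 𝟙 (lookup p j)
    ≡⟨ cong (𝟙 x +_) (∣p∣≡∑ p) ⟨
  𝟙 x + ∣ p ∣ ∎
  where open ≡-Reasoning

∣removeAt∣ : ∀ {n} (p : Subset (suc n)) i → ∣ p ∣ ≡ 𝟙 (lookup p i) + ∣ removeAt p i ∣
∣removeAt∣ p i = trans (cong ∣_∣ (sym (insertAt-removeAt p i))) (∣insertAt∣ (removeAt p i) i (lookup p i))

∣removeAt∣≤∣p∣ : ∀ {n} (p : Subset (suc n)) i → ∣ removeAt p i ∣ ≤ ∣ p ∣
∣removeAt∣≤∣p∣ p i = subst (∣ removeAt p i ∣ ≤_) (sym (∣removeAt∣ p i)) (m≤n+m _ _)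

∣p∣≤1+∣removeAt∣ : ∀ {n} (p : Subset (suc n)) i → ∣ p ∣ ≤ suc ∣ removeAt p i ∣
∣p∣≤1+∣removeAt∣ p i = subst (_≤ suc ∣ removeAt p i ∣) (sym (∣removeAt∣ p i)) (+-monoˡ-≤ _ (𝟙≤1 (lookup p i)))
  where
  𝟙≤1 : ∀ b → 𝟙 b ≤ 1
  𝟙≤1 true  = ≤-refl
  𝟙≤1 false = z≤n

∣removeAt∣-∉ : ∀ {n} (p : Subset (suc n)) {i} → i ∉ p → ∣ removeAt p i ∣ ≡ ∣ p ∣
∣removeAt∣-∉ p {i} i∉p with lookup p i in p[i] | ∣removeAt∣ p i
... | false | ∣p∣≡ = sym ∣p∣≡
... | true  | _    = contradiction (lookup⇒[]= i p p[i]) i∉p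

lookup-removeAt : ∀ {n} {A : Set} (xs : Vec A (suc n)) i j → lookup (removeAt xs i) j ≡ lookup xs (punchIn i j)
lookup-removeAt xs i j = trans (sym (insertAt-punchIn (removeAt xs i) i (lookup xs i) j))
                               (cong (λ ys → lookup ys (punchIn i j)) (insertAt-removeAt xs i))

∈-removeAt⁺ : ∀ {n} {p : Subset (suc n)} {i j} → punchIn i j ∈ p → j ∈ removeAt p i
∈-removeAt⁺ {p = p} {i} {j} ij∈p =
  lookup⇒[]= j (removeAt p i) (trans (lookup-removeAt p i j) ([]=⇒lookup ij∈p))

∈-removeAt⁻ : ∀ {n} {p : Subset (suc n)} {i j} → j ∈ removeAt p i → punchIn i j ∈ p
∈-removeAt⁻ {p = p} {i} {j} j∈p∖i =
  lookup⇒[]= (punchIn i j) p (trans (sym (lookup-removeAt p i j)) ([]=⇒lookup j∈p∖i))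

∈-insertAt⁺ : ∀ {n} {p : Subset n} {i j x} → j ∈ p → punchIn i j ∈ insertAt p i x
∈-insertAt⁺ {p = p} {i} {j} {x} j∈p =
  lookup⇒[]= (punchIn i j) (insertAt p i x) (trans (insertAt-punchIn p i x j) ([]=⇒lookup j∈p))

∈-insertAt⁻ : ∀ {n} {p : Subset n} {i j x} → punchIn i j ∈ insertAt p i x → j ∈ p
∈-insertAt⁻ {p = p} {i} {j} {x} ij∈p =
  lookup⇒[]= j p (trans (sym (insertAt-punchIn p i x j)) ([]=⇒lookup ij∈p))

i∉insertAt-outside : ∀ {n} (p : Subset n) i → i ∉ insertAt p i false
i∉insertAt-outside p i i∈p with () ← trans (sym (insertAt-lookup p i false)) ([]=⇒lookup i∈p)

∣q∣<∣p∣⇒∃[p∖q] : ∀ {n} {p q : Subset n} → ∣ q ∣ < ∣ p ∣ → ∃ λ x → x ∈ p × x ∉ q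
∣q∣<∣p∣⇒∃[p∖q] {n} {p} {q} ∣q∣<∣p∣ with ¬∀⟶∃¬ n _ (λ x → x ∈? p →-dec x ∈? q) p⊈q
  where
  p⊈q : ¬ (∀ x → x ∈ p → x ∈ q)
  p⊈q p⊆q = <⇒≱ ∣q∣<∣p∣ (p⊆q⇒∣p∣≤∣q∣ (p⊆q _))
... | x , x∈p⇏x∈q with x ∈? p
...   | yes x∈p = x , x∈p , λ x∈q → x∈p⇏x∈q (λ _ → x∈q)
...   | no  x∉p = contradiction (λ x∈p → contradiction x∈p x∉p) x∈p⇏x∈q

preimage : ∀ {n} → (Fin n → Fin n) → Subset n → Subset n
preimage f Y = tabulateᵥ (lookup Y ∘ f)

∈-preimage⁺ : ∀ {n} {f : Fin n → Fin n} {Y x} → f x ∈ Y → x ∈ preimage f Y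
∈-preimage⁺ {f = f} {Y} {x} fx∈Y =
  lookup⇒[]= x _ (trans (lookup∘tabulate (lookup Y ∘ f) x) ([]=⇒lookup fx∈Y))

∈-preimage⁻ : ∀ {n} {f : Fin n → Fin n} {Y x} → x ∈ preimage f Y → f x ∈ Y
∈-preimage⁻ {f = f} {Y} {x} x∈f⁻¹Y =
  lookup⇒[]= (f x) Y (trans (sym (lookup∘tabulate (lookup Y ∘ f) x)) ([]=⇒lookup x∈f⁻¹Y))

∣preimage∣ : ∀ {n} (π : Permutation n n) (p : Subset n) → ∣ preimage (π ⟨$⟩ʳ_) p ∣ ≡ ∣ p ∣
∣preimage∣ {n} π p = begin
  ∣ πp ∣                             ≡⟨ ∣p∣≡∑ πp ⟩
  ∑[ i < n ] 𝟙 (lookup πp i)         ≡⟨ sum-cong-≗ (cong 𝟙 ∘ lookup∘tabulate (lookup p ∘ (π ⟨$⟩ʳ_))) ⟩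
  ∑[ i < n ] 𝟙 (lookup p (π ⟨$⟩ʳ i)) ≡⟨ sum-permute (𝟙 ∘ lookup p) π ⟨
  ∑[ i < n ] 𝟙 (lookup p i)          ≡⟨ ∣p∣≡∑ p ⟨
  ∣ p ∣                              ∎
  where
  open ≡-Reasoning
  πp : Subset n
  πp = preimage (π ⟨$⟩ʳ_) p

-- Transporting along an automorphism

module _ {n} {G : Graph n} (π : Permutation n n)
         (π-auto : ∀ u v → adj G (π ⟨$⟩ʳ u) (π ⟨$⟩ʳ v) ≡ adj G u v) where

  private
    π⁻¹-≟ : ∀ y x → does ((π ⟨$⟩ˡ y) ≟ x) ≡ does (y ≟ (π ⟨$⟩ʳ x))
    π⁻¹-≟ y x with (π ⟨$⟩ˡ y) ≟ x | y ≟ (π ⟨$⟩ʳ x)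
    ... | yes _   | yes _   = refl
    ... | no  _   | no  _   = refl
    ... | yes π⁻¹y≡x | no y≢πx = contradiction (trans (sym (inverseʳ π)) (cong (π ⟨$⟩ʳ_) π⁻¹y≡x)) y≢πx
    ... | no π⁻¹y≢x  | yes y≡πx = contradiction (trans (cong (π ⟨$⟩ˡ_) y≡πx) (inverseˡ π)) π⁻¹y≢x

  preimage-CapAssignment : ∀ {c Y} → CapAssignment G c Y →
                           CapAssignment G (c ∘ (π ⟨$⟩ʳ_)) (preimage (π ⟨$⟩ʳ_) Y)
  preimage-CapAssignment {c} {Y} A = record
    { pick     = pick′
    ; pick-sym = λ u~v → cong (π ⟨$⟩ˡ_) (pick-sym (πu~πv u~v))
    ; pick-end = λ u~v → Sum.map (π⁻¹-cong) π⁻¹-cong (pick-end (πu~πv u~v))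
    ; pick-∈   = λ u~v → ∈-preimage⁺ (subst (_∈ Y) (sym (inverseʳ π)) (pick-∈ (πu~πv u~v)))
    ; owned≤c  = λ {x} x∈π⁻¹Y →
        subst (_≤ c (π ⟨$⟩ʳ x)) (sym (owned-pick′ x)) (owned≤c (∈-preimage⁻ x∈π⁻¹Y))
    }
    where
    open CapAssignment A
    pick′ : Fin n → Fin n → Fin n
    pick′ u v = π ⟨$⟩ˡ pick (π ⟨$⟩ʳ u) (π ⟨$⟩ʳ v)
    πu~πv : ∀ {u v} → adj G u v ≡ true → adj G (π ⟨$⟩ʳ u) (π ⟨$⟩ʳ v) ≡ true
    πu~πv {u} {v} = trans (π-auto u v)
    π⁻¹-cong : ∀ {y u} → y ≡ π ⟨$⟩ʳ u → π ⟨$⟩ˡ y ≡ u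
    π⁻¹-cong refl = inverseˡ π
    owned-pick′ : ∀ x → owned G pick′ x ≡ owned G pick (π ⟨$⟩ʳ x)
    owned-pick′ x = begin
      ∑[ v < n ] owns G pick′ x v
        ≡⟨ sum-cong-≗ (λ v → cong₂ (λ a b → 𝟙 (a ∧ b)) (sym (π-auto x v)) (π⁻¹-≟ _ x)) ⟩
      ∑[ v < n ] owns G pick (π ⟨$⟩ʳ x) (π ⟨$⟩ʳ v)
        ≡⟨ sum-permute (owns G pick (π ⟨$⟩ʳ x)) π ⟨
      ∑[ v < n ] owns G pick (π ⟨$⟩ʳ x) v ∎
      where open ≡-Reasoning

module _ {n} (s t : Fin n) where

  transpose-sʳ : transpose s t ⟨$⟩ʳ s ≡ t
  transpose-sʳ rewrite dec-true (s ≟ s) refl = refl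

  transpose-tʳ : transpose s t ⟨$⟩ʳ t ≡ s
  transpose-tʳ with t ≟ s
  ... | yes refl = refl
  ... | no _ rewrite dec-true (t ≟ t) refl = refl

  transpose-≢ʳ : ∀ {u} → u ≢ s → u ≢ t → transpose s t ⟨$⟩ʳ u ≡ u
  transpose-≢ʳ {u} u≢s u≢t rewrite dec-false (u ≟ s) u≢s | dec-false (u ≟ t) u≢t = refl

  transpose-automorphism : ∀ (G : Graph n) → (∀ w → adj G s w ≡ adj G t w) →
                           ∀ u v → adj G (transpose s t ⟨$⟩ʳ u) (transpose s t ⟨$⟩ʳ v) ≡ adj G u v
  transpose-automorphism G same-neighbours u v = begin
    adj G (τ u) (τ v)  ≡⟨ adj-τ u (τ v) ⟩
    adj G u (τ v)      ≡⟨ adj-sym G u (τ v) ⟩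
    adj G (τ v) u      ≡⟨ adj-τ v u ⟩
    adj G v u          ≡⟨ adj-sym G v u ⟩
    adj G u v          ∎
    where
    open ≡-Reasoning
    τ : Fin n → Fin n
    τ = transpose s t ⟨$⟩ʳ_
    adj-τ : ∀ u w → adj G (τ u) w ≡ adj G u w
    adj-τ u w = by-cases (u ≟ s) (u ≟ t)
      where
      by-cases : ∀ {u} → Dec (u ≡ s) → Dec (u ≡ t) → adj G (τ u) w ≡ adj G u w
      by-cases (yes refl) _          = trans (cong (λ y → adj G y w) transpose-sʳ) (sym (same-neighbours w))
      by-cases (no _)     (yes refl) = trans (cong (λ y → adj G y w) transpose-tʳ) (same-neighbours w)
      by-cases (no u≢s)   (no u≢t)   = cong (λ y → adj G y w) (transpose-≢ʳ u≢s u≢t)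

  transpose-capacity : ∀ (c : Fin n → ℕ) → c s ≤ c t → ∀ {x} → x ≢ s → c (transpose s t ⟨$⟩ʳ x) ≤ c x
  transpose-capacity c cs≤ct {x} x≢s with x ≟ t
  ... | yes refl = subst (λ y → c y ≤ c x) (sym transpose-tʳ) cs≤ct
  ... | no x≢t   = subst (λ y → c y ≤ c x) (sym (transpose-≢ʳ x≢s x≢t)) ≤-refl

-- Deleting a vertex outside the cover

punchIn-≟ : ∀ {m} (s : Fin (suc m)) (a b : Fin m) → does (punchIn s a ≟ punchIn s b) ≡ does (a ≟ b)
punchIn-≟ s a b with a ≟ b
... | yes refl = dec-true (punchIn s a ≟ punchIn s a) refl
... | no a≢b   = dec-false (punchIn s a ≟ punchIn s b) (a≢b ∘ punchIn-injective s a b)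

𝟙+≤⇒≤reduced : ∀ b {n c} → 𝟙 b + n ≤ c → n ≤ (if b then c ∸ 1 else c)
𝟙+≤⇒≤reduced true  (s≤s n≤c) = n≤c
𝟙+≤⇒≤reduced false n≤c       = n≤c

-- The side condition is needed because c ∸ 1 truncates at 0.
≤reduced⇒𝟙+≤ : ∀ b {n c} → n ≤ (if b then c ∸ 1 else c) → (b ≡ true → 1 ≤ c) → 𝟙 b + n ≤ c
≤reduced⇒𝟙+≤ true  {c = suc c} n≤c _  = s≤s n≤c
≤reduced⇒𝟙+≤ true  {c = zero}  _   1≤0 with () ← 1≤0 refl
≤reduced⇒𝟙+≤ false n≤c _ = n≤c

reduced≤ : ∀ b {c} → (if b then c ∸ 1 else c) ≤ c
reduced≤ true  = m∸n≤m _ 1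
reduced≤ false = ≤-refl

data PunchInView {m} (s : Fin (suc m)) : Fin (suc m) → Set where
  hole    : PunchInView s s
  punched : ∀ a → PunchInView s (punchIn s a)

punchInView : ∀ {m} (s v : Fin (suc m)) → PunchInView s v
punchInView         zero    zero    = hole
punchInView         zero    (suc a) = punched a
punchInView {suc m} (suc s) zero    = punched zero
punchInView {suc m} (suc s) (suc v) with punchInView s v
... | hole      = hole
... | punched a = punched (suc a)

punchInView-hole : ∀ {m} (s : Fin (suc m)) → punchInView s s ≡ hole
punchInView-hole         zero    = refl
punchInView-hole {suc m} (suc s) rewrite punchInView-hole s = refl

punchInView-punchIn : ∀ {m} (s : Fin (suc m)) a → punchInView s (punchIn s a) ≡ punched a
punchInView-punchIn         zero    a       = refl
punchInView-punchIn {suc m} (suc s) zero    = refl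
punchInView-punchIn {suc m} (suc s) (suc a) rewrite punchInView-punchIn s a = refl

module _ {m} (G : Graph (suc m)) (s : Fin (suc m)) where

  private
    G′ : Graph m
    G′ = deleteVertex G s
    p : Fin m → Fin (suc m)
    p = punchIn s

  owned-punchIn : (f : Fin (suc m) → Fin (suc m) → Fin (suc m)) (f′ : Fin m → Fin m → Fin m) →
                  (∀ {a b} → adj G′ a b ≡ true → p (f′ a b) ≡ f (p a) (p b)) →
                  ∀ a → owned G f (p a) ≡ owns G f (p a) s + owned G′ f′ a
  owned-punchIn f f′ f′-punchIn a =
    trans (sum-remove {i = s} (owns G f (p a))) (cong (owns G f (p a) s +_) (sum-cong-≗ owns-p))
    where
    owns-p : ∀ b → owns G f (p a) (p b) ≡ owns G′ f′ a b
    owns-p b with adj G (p a) (p b) in a~b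
    ... | false = refl
    ... | true  = cong 𝟙 (trans (cong (λ y → does (y ≟ p a)) (sym (f′-punchIn a~b))) (punchIn-≟ s (f′ a b) a))

  restrict : ∀ {c Y} → s ∉ Y → CapAssignment G c Y → CapAssignment G′ (reducedCapacity G c s) (removeAt Y s)
  restrict {c} {Y} s∉Y A = record
    { pick     = pick′
    ; pick-sym = λ {a} {b} a~b → punchIn-injective s _ _
                   (trans (p-pick′ a~b) (trans (pick-sym a~b) (sym (p-pick′ (trans (adj-sym G′ b a) a~b)))))
    ; pick-end = pick′-end
    ; pick-∈   = λ {a} {b} a~b → ∈-removeAt⁺ {p = Y} (subst (_∈ Y) (sym (p-pick′ a~b)) (pick-∈ a~b))
    ; owned≤c  = owned′≤c′ ∘ ∈-removeAt⁻ {p = Y}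
    }
    where
    open CapAssignment A
    pick′ : Fin m → Fin m → Fin m
    pick′ a b = if does (pick (p a) (p b) ≟ p a) then a else b
    pick′-end : ∀ {a b} → adj G′ a b ≡ true → pick′ a b ≡ a ⊎ pick′ a b ≡ b
    pick′-end {a} {b} _ with does (pick (p a) (p b) ≟ p a)
    ... | true  = inj₁ refl
    ... | false = inj₂ refl
    p-pick′ : ∀ {a b} → adj G′ a b ≡ true → p (pick′ a b) ≡ pick (p a) (p b)
    p-pick′ {a} {b} a~b with pick (p a) (p b) ≟ p a
    ... | yes pick≡pa = sym pick≡pa
    ... | no  pick≢pa with pick-end a~b
    ...   | inj₁ pick≡pa = contradiction pick≡pa pick≢pa
    ...   | inj₂ pick≡pb = sym pick≡pb
    owned′≤c′ : ∀ {a} → p a ∈ Y → owned G′ pick′ a ≤ reducedCapacity G c s a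
    owned′≤c′ {a} pa∈Y = 𝟙+≤⇒≤reduced (adj G s (p a)) (begin
      𝟙 (adj G s (p a)) + owned G′ pick′ a    ≡⟨ cong (λ b → 𝟙 b + owned G′ pick′ a) (adj-sym G s (p a)) ⟩
      𝟙 (adj G (p a) s) + owned G′ pick′ a    ≡⟨ cong (_+ owned G′ pick′ a) (owns-∉ A s∉Y (p a)) ⟨
      owns G pick (p a) s + owned G′ pick′ a  ≡⟨ owned-punchIn pick pick′ p-pick′ a ⟨
      owned G pick (p a)                      ≤⟨ owned≤c pa∈Y ⟩
      c (p a)                                 ∎)
      where open ≤-Reasoning

  extendPick : (Fin m → Fin m → Fin m) → Fin (suc m) → Fin (suc m) → Fin (suc m)
  extendPick f u v with punchInView s u | punchInView s v
  ... | hole      | _         = v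
  ... | punched _ | hole      = u
  ... | punched a | punched b = p (f a b)

  module _ (f : Fin m → Fin m → Fin m) where

    extendPick-s : ∀ v → extendPick f s v ≡ v
    extendPick-s v rewrite punchInView-hole s = refl

    extendPick-p-s : ∀ a → extendPick f (p a) s ≡ p a
    extendPick-p-s a rewrite punchInView-punchIn s a | punchInView-hole s = refl

    extendPick-p-p : ∀ a b → extendPick f (p a) (p b) ≡ p (f a b)
    extendPick-p-p a b rewrite punchInView-punchIn s a | punchInView-punchIn s b = refl

  module _ {f : Fin m → Fin m → Fin m} where

    extendPick-sym : (∀ {a b} → adj G′ a b ≡ true → f a b ≡ f b a) →
                     ∀ {u v} → adj G u v ≡ true → extendPick f u v ≡ extendPick f v u
    extendPick-sym f-sym {u} {v} = by-view (punchInView s u) (punchInView s v)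
      where
      by-view : ∀ {u v} → PunchInView s u → PunchInView s v → adj G u v ≡ true → extendPick f u v ≡ extendPick f v u
      by-view hole        hole        s~s = contradiction refl (adj⇒≢ G s~s)
      by-view hole        (punched b) _   = trans (extendPick-s f (p b)) (sym (extendPick-p-s f b))
      by-view (punched a) hole        _   = trans (extendPick-p-s f a) (sym (extendPick-s f (p a)))
      by-view (punched a) (punched b) a~b = begin
        extendPick f (p a) (p b)  ≡⟨ extendPick-p-p f a b ⟩
        p (f a b)                 ≡⟨ cong p (f-sym a~b) ⟩
        p (f b a)                 ≡⟨ extendPick-p-p f b a ⟨
        extendPick f (p b) (p a)  ∎
        where open ≡-Reasoning

    extendPick-end : (∀ {a b} → adj G′ a b ≡ true → f a b ≡ a ⊎ f a b ≡ b) →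
                     ∀ {u v} → adj G u v ≡ true → extendPick f u v ≡ u ⊎ extendPick f u v ≡ v
    extendPick-end f-end {u} {v} = by-view (punchInView s u) (punchInView s v)
      where
      by-view : ∀ {u v} → PunchInView s u → PunchInView s v → adj G u v ≡ true →
                extendPick f u v ≡ u ⊎ extendPick f u v ≡ v
      by-view hole        hole        s~s = contradiction refl (adj⇒≢ G s~s)
      by-view hole        (punched b) _   = inj₂ (extendPick-s f (p b))
      by-view (punched a) hole        _   = inj₁ (extendPick-p-s f a)
      by-view (punched a) (punched b) a~b rewrite extendPick-p-p f a b = Sum.map (cong p) (cong p) (f-end a~b)

  extend : ∀ {c Y′} → (∀ {a} → adj G s (p a) ≡ true → a ∈ Y′ × 1 ≤ c (p a)) →
           CapAssignment G′ (reducedCapacity G c s) Y′ → CapAssignment G c (insertAt Y′ s false)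
  extend {c} {Y′} neighbours A′ = record
    { pick     = pick
    ; pick-sym = extendPick-sym pick′-sym
    ; pick-end = extendPick-end pick′-end
    ; pick-∈   = λ {u} {v} → pick-∈-by (punchInView s u) (punchInView s v)
    ; owned≤c  = λ {x} → owned≤c-by (punchInView s x)
    }
    where
    open CapAssignment A′ renaming (pick to pick′; pick-sym to pick′-sym; pick-end to pick′-end;
                                    pick-∈ to pick′-∈; owned≤c to owned′≤c′)
    Y : Subset (suc m)
    Y = insertAt Y′ s false
    pick : Fin (suc m) → Fin (suc m) → Fin (suc m)
    pick = extendPick pick′
    pick-∈-by : ∀ {u v} → PunchInView s u → PunchInView s v → adj G u v ≡ true → pick u v ∈ Y
    pick-∈-by hole        hole        s~s = contradiction refl (adj⇒≢ G s~s)
    pick-∈-by hole        (punched b) s~b rewrite extendPick-s pick′ (p b) =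
      ∈-insertAt⁺ {p = Y′} (proj₁ (neighbours s~b))
    pick-∈-by (punched a) hole        a~s rewrite extendPick-p-s pick′ a =
      ∈-insertAt⁺ {p = Y′} (proj₁ (neighbours (trans (adj-sym G s (p a)) a~s)))
    pick-∈-by (punched a) (punched b) a~b rewrite extendPick-p-p pick′ a b = ∈-insertAt⁺ {p = Y′} (pick′-∈ a~b)
    owns-p-s : ∀ a → owns G pick (p a) s ≡ 𝟙 (adj G s (p a))
    owns-p-s a rewrite extendPick-p-s pick′ a | dec-true (p a ≟ p a) refl
                     | ∧-identityʳ (adj G (p a) s) | adj-sym G (p a) s = refl
    owned≤c-by : ∀ {x} → PunchInView s x → x ∈ Y → owned G pick x ≤ c x
    owned≤c-by hole        s∈Y  = contradiction s∈Y (i∉insertAt-outside Y′ s)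
    owned≤c-by (punched a) pa∈Y = begin
      owned G pick (p a)                      ≡⟨ owned-punchIn pick pick′ (λ _ → sym (extendPick-p-p pick′ _ _)) a ⟩
      owns G pick (p a) s + owned G′ pick′ a  ≡⟨ cong (_+ owned G′ pick′ a) (owns-p-s a) ⟩
      𝟙 (adj G s (p a)) + owned G′ pick′ a
        ≤⟨ ≤reduced⇒𝟙+≤ (adj G s (p a)) (owned′≤c′ (∈-insertAt⁻ pa∈Y)) (proj₂ ∘ neighbours) ⟩
      c (p a)                                 ∎
      where open ≤-Reasoning

-- The reduction

module _ {m} (G : Graph (suc m)) (k : ℕ) (c : Fin (suc m) → ℕ) (S : Subset (suc m))
         (S-twins : ∀ {u v} → u ∈ S → v ∈ S → ∀ w → adj G u w ≡ adj G v w)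
         (k+1<∣S∣ : suc k < ∣ S ∣)
         (s : Fin (suc m)) (s∈S : s ∈ S) (s-min : ∀ v → v ∈ S → c s ≤ c v) where

  private
    G′ : Graph m
    G′ = deleteVertex G s
    c′ : Fin m → ℕ
    c′ = reducedCapacity G c s
    p : Fin m → Fin (suc m)
    p = punchIn s
    ∣Z∣<∣S∖s∣ : ∀ {Z : Subset m} → ∣ Z ∣ ≤ k → ∣ Z ∣ < ∣ removeAt S s ∣
    ∣Z∣<∣S∖s∣ ∣Z∣≤k = s≤s⁻¹ (≤-trans (≤-trans (s≤s (s≤s ∣Z∣≤k)) k+1<∣S∣) (∣p∣≤1+∣removeAt∣ S s))

  another-twin : ∀ {Z : Subset m} → ∣ Z ∣ ≤ k → ∃ λ a → p a ∈ S × a ∉ Z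
  another-twin {Z} ∣Z∣≤k with ∣q∣<∣p∣⇒∃[p∖q] {p = removeAt S s} {q = Z} (∣Z∣<∣S∖s∣ {Z} ∣Z∣≤k)
  ... | a , a∈S∖s , a∉Z = a , ∈-removeAt⁻ {p = S} a∈S∖s , a∉Z

  reduce-forward : YesInstance G k c → YesInstance G′ k c′
  reduce-forward (Y , ∣Y∣≤k , Y-cover)
    with another-twin {removeAt Y s} (≤-trans (∣removeAt∣≤∣p∣ Y s) ∣Y∣≤k)
  ... | a , t∈S , a∉Y∖s = removeAt Z s , ∣Z∖s∣≤k , toCapVertexCover (restrict G s s∉Z Z-assignment)
    where
    t : Fin (suc m)
    t = p a
    τ : Fin (suc m) → Fin (suc m)
    τ = transpose s t ⟨$⟩ʳ_
    Z : Subset (suc m)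
    Z = preimage τ Y
    t∉Y : t ∉ Y
    t∉Y = a∉Y∖s ∘ ∈-removeAt⁺ {p = Y}
    s∉Z : s ∉ Z
    s∉Z s∈Z = t∉Y (subst (_∈ Y) (transpose-sʳ s t) (∈-preimage⁻ {f = τ} {Y} s∈Z))
    Z-assignment : CapAssignment G c Z
    Z-assignment = weaken-capacity
      (preimage-CapAssignment (transpose s t) (transpose-automorphism s t G (S-twins s∈S t∈S))
                              (fromCapVertexCover Y-cover))
      (λ x∈Z → transpose-capacity s t c (s-min t t∈S) (λ { refl → s∉Z x∈Z }))
    ∣Z∖s∣≤k : ∣ removeAt Z s ∣ ≤ k
    ∣Z∖s∣≤k = ≤-trans (≤-reflexive (trans (∣removeAt∣-∉ Z s∉Z) (∣preimage∣ (transpose s t) Y))) ∣Y∣≤k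

  reduce-backward : YesInstance G′ k c′ → YesInstance G k c
  reduce-backward (Y′ , ∣Y′∣≤k , Y′-cover) with another-twin ∣Y′∣≤k
  ... | a , t∈S , a∉Y′ =
    insertAt Y′ s false , subst (_≤ k) (sym (∣insertAt∣ Y′ s false)) ∣Y′∣≤k ,
    toCapVertexCover (extend G s neighbours A′)
    where
    A′ : CapAssignment G′ c′ Y′
    A′ = fromCapVertexCover Y′-cover
    neighbours : ∀ {b} → adj G s (p b) ≡ true → b ∈ Y′ × 1 ≤ c (p b)
    neighbours {b} s~b = b∈Y′ , ≤-trans 1≤c′b (reduced≤ (adj G s (p b)))
      where
      open CapAssignment A′ using (pick; owned≤c)
      a~b : adj G′ a b ≡ true
      a~b = trans (S-twins t∈S s∈S (p b)) s~b
      b~a : adj G′ b a ≡ true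
      b~a = trans (adj-sym G′ b a) a~b
      b∈Y′ : b ∈ Y′
      b∈Y′ = adj-∉ A′ a∉Y′ b~a
      1≤c′b : 1 ≤ c′ b
      1≤c′b = begin
        1                  ≡⟨ cong 𝟙 b~a ⟨
        𝟙 (adj G′ b a)     ≡⟨ owns-∉ A′ a∉Y′ b ⟨
        owns G′ pick b a   ≤⟨ owns≤owned G′ pick b a ⟩
        owned G′ pick b    ≤⟨ owned≤c b∈Y′ ⟩
        c′ b               ∎
        where open ≤-Reasoning

lemma25 : ∀ {m} (G : Graph (suc m)) (k : ℕ) (c : Fin (suc m) → ℕ)
          (X : Subset (suc m)) → IsVertexCover G X →
          (S : Subset (suc m)) →
          (∀ v → v ∈ S → v ∉ X) →
          (∀ u v x → u ∈ S → v ∈ S → x ∈ X → adj G u x ≡ adj G v x) →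
          suc k < ∣ S ∣ →
          (s : Fin (suc m)) → s ∈ S → (∀ v → v ∈ S → c s ≤ c v) →
          YesInstance G k c ⇔ YesInstance (deleteVertex G s) k (reducedCapacity G c s)
lemma25 G k c X X-cover S S∩X≡∅ same-in-X k+1<∣S∣ s s∈S s-min =
  mk⇔ (reduce-forward  G k c S S-twins k+1<∣S∣ s s∈S s-min)
      (reduce-backward G k c S S-twins k+1<∣S∣ s s∈S s-min)
  where
  S-twins : ∀ {u v} → u ∈ S → v ∈ S → ∀ w → adj G u w ≡ adj G v w
  S-twins {u} {v} u∈S v∈S =
    twins {G = G} X-cover (S∩X≡∅ u u∈S) (S∩X≡∅ v v∈S) (λ x x∈X → same-in-X u v x u∈S v∈S x∈X)
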